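{- Let $X\subseteq B^h$, $G=Q_h(X)$, and let $x,y\in\widehat X$ with $x\ne y$. If $u\in I_G(0^h,x)$ and $v\in I_G(0^h,y)$ are such that $u,v\notin I_G(0^h,x)\cap I_G(0^h,y)$, then $uv\notin E(G)$.
   Context: $B=\{0,1\}$, $B^h$ binary words of length $h$, $Q_h$ the hypercube on $B^h$ (adjacent iff Hamming distance $1$). $u\le v$ means $u_i\le v_i$ for all $i$. For $X\subseteq B^h$, $\widehat X$ is the set of maximal elements of $(X,\le)$ and the daisy cube $Q_h(X)$ is the subgraph of $Q_h$ induced by $\{v: v\le x\text{ for some }x\in X\}$. $I_G(a,b)$ is the set of vertices lying on shortest $a,b$-paths in $G$. -}

module Defs where

open import Data.Nat using (ℕ; zero; suc; _+_; _≤_)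
open import Data.Bool using (Bool; true; false)
import Data.Bool as B
open import Data.Vec using (Vec; []; _∷_; replicate)
open import Data.Vec.Relation.Binary.Pointwise.Inductive using (Pointwise)
open import Data.Product using (Σ; ∃; _×_)
open import Relation.Binary.PropositionalEquality using (_≡_)
open import Relation.Nullary using (¬_)

Word : ℕ → Set
Word h = Vec Bool h

0ʰ : (h : ℕ) → Word h
0ʰ h = replicate h false

_≤ʷ_ : ∀ {h} → Word h → Word h → Set
u ≤ʷ v = Pointwise B._≤_ u v

hamming : ∀ {h} → Word h → Word h → ℕ
hamming [] [] = 0
hamming (a ∷ u) (b ∷ v) with a B.≟ b
... | Relation.Nullary.yes _ = hamming u v
... | Relation.Nullary.no  _ = suc (hamming u v)

AdjQ : ∀ {h} → Word h → Word h → Set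
AdjQ u v = hamming u v ≡ 1

Subset : ℕ → Set₁
Subset h = Word h → Set

Maximal : ∀ {h} → Subset h → Word h → Set
Maximal X x = X x × (∀ z → X z → x ≤ʷ z → z ≡ x)

VQ : ∀ {h} → Subset h → Word h → Set
VQ X v = ∃ λ x → X x × v ≤ʷ x

EdgeQ : ∀ {h} → Subset h → Word h → Word h → Set
EdgeQ X u v = VQ X u × VQ X v × AdjQ u v

data Walk {h} (X : Subset h) : Word h → Word h → ℕ → Set where
  stay : ∀ {a} → VQ X a → Walk X a a 0
  step : ∀ {a b c n} → EdgeQ X a b → Walk X b c n → Walk X a c (suc n)

-- interval I_G(a,b) in G = Q_h(X): vertices on shortest a,b-paths
Interval : ∀ {h} → Subset h → Word h → Word h → Word h → Set
Interval X a b w =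
  Σ ℕ λ m → Σ ℕ λ n → Walk X a w m × Walk X w b n ×
    (∀ k → Walk X a b k → m + n ≤ k)

-- In G = Q_h(X) no walk is shorter than the Hamming distance of its ends, and
-- every vertex below x ∈ V(G) reaches x by an upward path of exactly that
-- length; hence I_G(0ʰ, x) is the down-set of x in G. Adjacent words are
-- comparable, so for an edge uv with u ≤ v ≤ y the vertex u lies in I_G(0ʰ, y)
-- as well (symmetrically for v ≤ u ≤ x).
module Submission where

open import Defs
open import Data.Bool using (Bool; true; false)
import Data.Bool as B
import Data.Bool.Properties as BP
open import Data.Empty using (⊥-elim)
open import Data.Nat using (ℕ; zero; suc; pred; _+_; _≤_; z≤n; s≤s)
open import Data.Nat.Properties
  using (≤-trans; ≤-refl; ≤-reflexive; +-mono-≤; +-suc; n≤1+n; 1+n≰n; +-commutativeSemigroup)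
open import Algebra.Properties.CommutativeSemigroup +-commutativeSemigroup using (interchange)
open import Data.Product using (_×_; _,_; Σ)
open import Data.Sum using (_⊎_; inj₁; inj₂)
open import Data.Vec using ([]; _∷_)
open import Data.Vec.Relation.Binary.Pointwise.Inductive as Pointwise using ([]; _∷_)
open import Relation.Binary.PropositionalEquality using (_≡_; refl; sym; trans; cong; subst)
open import Relation.Nullary using (¬_)

bitDistance : Bool → Bool → ℕ
bitDistance false false = 0
bitDistance true  true  = 0
bitDistance false true  = 1
bitDistance true  false = 1

hamming-∷ : ∀ {h} a b (u v : Word h) →
  hamming (a ∷ u) (b ∷ v) ≡ bitDistance a b + hamming u v
hamming-∷ false false u v = refl
hamming-∷ false true  u v = refl
hamming-∷ true  false u v = refl
hamming-∷ true  true  u v = refl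

hamming-self : ∀ {h} (u : Word h) → hamming u u ≡ 0
hamming-self []          = refl
hamming-self (false ∷ u) = hamming-self u
hamming-self (true ∷ u)  = hamming-self u

hamming≡0⇒≡ : ∀ {h} {u v : Word h} → hamming u v ≡ 0 → u ≡ v
hamming≡0⇒≡ {u = []}        {[]}        _ = refl
hamming≡0⇒≡ {u = false ∷ u} {false ∷ v} e = cong (false ∷_) (hamming≡0⇒≡ e)
hamming≡0⇒≡ {u = true ∷ u}  {true ∷ v}  e = cong (true ∷_) (hamming≡0⇒≡ e)

bitDistance-triangle : ∀ a b c → bitDistance a c ≤ bitDistance a b + bitDistance b c
bitDistance-triangle false false c     = ≤-refl
bitDistance-triangle true  true  c     = ≤-refl
bitDistance-triangle false true  false = z≤n
bitDistance-triangle false true  true  = s≤s z≤n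
bitDistance-triangle true  false false = s≤s z≤n
bitDistance-triangle true  false true  = z≤n

hamming-triangle : ∀ {h} (u v w : Word h) → hamming u w ≤ hamming u v + hamming v w
hamming-triangle [] [] [] = z≤n
hamming-triangle (a ∷ u) (b ∷ v) (c ∷ w)
  rewrite hamming-∷ a c u w | hamming-∷ a b u v | hamming-∷ b c v w =
  ≤-trans (+-mono-≤ (bitDistance-triangle a b c) (hamming-triangle u v w))
          (≤-reflexive (interchange (bitDistance a b) (bitDistance b c) (hamming u v) (hamming v w)))

≤ʷ-refl : ∀ {h} {u : Word h} → u ≤ʷ u
≤ʷ-refl = Pointwise.refl BP.≤-refl

≤ʷ-trans : ∀ {h} {u v w : Word h} → u ≤ʷ v → v ≤ʷ w → u ≤ʷ w
≤ʷ-trans = Pointwise.trans BP.≤-trans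

0ʰ-≤ʷ : ∀ {h} (u : Word h) → 0ʰ h ≤ʷ u
0ʰ-≤ʷ []          = []
0ʰ-≤ʷ (false ∷ u) = B.b≤b ∷ 0ʰ-≤ʷ u
0ʰ-≤ʷ (true ∷ u)  = B.f≤t ∷ 0ʰ-≤ʷ u

≤ʷ⇒hamming-additive : ∀ {h} {u x : Word h} → u ≤ʷ x →
  hamming (0ʰ h) u + hamming u x ≡ hamming (0ʰ h) x
≤ʷ⇒hamming-additive [] = refl
≤ʷ⇒hamming-additive {u = false ∷ u} {false ∷ x} (B.b≤b ∷ u≤x) = ≤ʷ⇒hamming-additive u≤x
≤ʷ⇒hamming-additive {u = true ∷ u}  {true ∷ x}  (B.b≤b ∷ u≤x) = cong suc (≤ʷ⇒hamming-additive u≤x)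
≤ʷ⇒hamming-additive {u = false ∷ u} {true ∷ x}  (B.f≤t ∷ u≤x) =
  trans (+-suc (hamming (0ʰ _) u) (hamming u x)) (cong suc (≤ʷ⇒hamming-additive u≤x))

hamming-additive⇒≤ʷ : ∀ {h} (u x : Word h) →
  hamming (0ʰ h) u + hamming u x ≤ hamming (0ʰ h) x → u ≤ʷ x
hamming-additive⇒≤ʷ [] [] _ = []
hamming-additive⇒≤ʷ (false ∷ u) (false ∷ x) p       = B.b≤b ∷ hamming-additive⇒≤ʷ u x p
hamming-additive⇒≤ʷ (true ∷ u)  (true ∷ x)  (s≤s p) = B.b≤b ∷ hamming-additive⇒≤ʷ u x p
hamming-additive⇒≤ʷ (false ∷ u) (true ∷ x)  p
  rewrite +-suc (hamming (0ʰ _) u) (hamming u x) with p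
... | s≤s p′ = B.f≤t ∷ hamming-additive⇒≤ʷ u x p′
hamming-additive⇒≤ʷ {suc h} (true ∷ u) (false ∷ x) p
  rewrite +-suc (hamming (0ʰ h) u) (hamming u x) =
  ⊥-elim (1+n≰n (≤-trans (n≤1+n _) (≤-trans p (hamming-triangle (0ʰ h) u x))))

adjacent⇒comparable : ∀ {h} {u v : Word h} → AdjQ u v → u ≤ʷ v ⊎ v ≤ʷ u
adjacent⇒comparable {u = []} {[]} ()
adjacent⇒comparable {u = false ∷ u} {false ∷ v} e with adjacent⇒comparable e
... | inj₁ u≤v = inj₁ (B.b≤b ∷ u≤v)
... | inj₂ v≤u = inj₂ (B.b≤b ∷ v≤u)
adjacent⇒comparable {u = true ∷ u} {true ∷ v} e with adjacent⇒comparable e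
... | inj₁ u≤v = inj₁ (B.b≤b ∷ u≤v)
... | inj₂ v≤u = inj₂ (B.b≤b ∷ v≤u)
adjacent⇒comparable {u = false ∷ u} {true ∷ v} e with hamming≡0⇒≡ {u = u} {v} (cong pred e)
... | refl = inj₁ (B.f≤t ∷ ≤ʷ-refl)
adjacent⇒comparable {u = true ∷ u} {false ∷ v} e with hamming≡0⇒≡ {u = u} {v} (cong pred e)
... | refl = inj₂ (B.f≤t ∷ ≤ʷ-refl)

≤ʷ-cover-step : ∀ {h} {u v : Word h} n → u ≤ʷ v → hamming u v ≡ suc n →
  Σ (Word h) λ w → AdjQ u w × w ≤ʷ v × hamming w v ≡ n
≤ʷ-cover-step {u = false ∷ u} {true ∷ v} n (B.f≤t ∷ u≤v) e =
  true ∷ u , cong suc (hamming-self u) , B.b≤b ∷ u≤v , cong pred e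
≤ʷ-cover-step {u = false ∷ u} {false ∷ v} n (B.b≤b ∷ u≤v) e with ≤ʷ-cover-step n u≤v e
... | w , u~w , w≤v , e′ = false ∷ w , u~w , B.b≤b ∷ w≤v , e′
≤ʷ-cover-step {u = true ∷ u} {true ∷ v} n (B.b≤b ∷ u≤v) e with ≤ʷ-cover-step n u≤v e
... | w , u~w , w≤v , e′ = true ∷ w , u~w , B.b≤b ∷ w≤v , e′

module _ {h} {X : Subset h} where

  ∈⇒∈VQ : ∀ {x} → X x → VQ X x
  ∈⇒∈VQ {x} x∈X = x , x∈X , ≤ʷ-refl

  VQ-downward : ∀ {u v} → u ≤ʷ v → VQ X v → VQ X u
  VQ-downward u≤v (x , x∈X , v≤x) = x , x∈X , ≤ʷ-trans u≤v v≤x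

  walk-length≥hamming : ∀ {u v k} → Walk X u v k → hamming u v ≤ k
  walk-length≥hamming {u} (stay _) rewrite hamming-self u = z≤n
  walk-length≥hamming {u} {w} (step {b = v} (_ , _ , u~v) walk) =
    ≤-trans (hamming-triangle u v w)
            (subst (λ d → d + hamming v w ≤ _) (sym u~v) (s≤s (walk-length≥hamming walk)))

  upward-walk : ∀ {u v} → u ≤ʷ v → VQ X v → Walk X u v (hamming u v)
  upward-walk {v = v} u≤v v∈G = go _ refl u≤v
    where
    go : ∀ n {w} → hamming w v ≡ n → w ≤ʷ v → Walk X w v n
    go zero {w} e _  with hamming≡0⇒≡ {u = w} {v} e
    ... | refl = stay v∈G
    go (suc n) e w≤v with ≤ʷ-cover-step n w≤v e
    ... | w′ , w~w′ , w′≤v , e′ =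
      step (VQ-downward w≤v v∈G , VQ-downward w′≤v v∈G , w~w′) (go n e′ w′≤v)

  interval-0ʰ⇒≤ʷ : ∀ {x u} → VQ X x → Interval X (0ʰ h) x u → u ≤ʷ x
  interval-0ʰ⇒≤ʷ {x} {u} x∈G (_ , _ , walk₁ , walk₂ , shortest) =
    hamming-additive⇒≤ʷ u x
      (≤-trans (+-mono-≤ (walk-length≥hamming walk₁) (walk-length≥hamming walk₂))
               (shortest _ (upward-walk (0ʰ-≤ʷ x) x∈G)))

  ≤ʷ⇒interval-0ʰ : ∀ {x u} → VQ X x → u ≤ʷ x → Interval X (0ʰ h) x u
  ≤ʷ⇒interval-0ʰ {x} {u} x∈G u≤x =
    hamming (0ʰ h) u , hamming u x ,
    upward-walk (0ʰ-≤ʷ u) (VQ-downward u≤x x∈G) , upward-walk u≤x x∈G ,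
    λ k walk → subst (_≤ k) (sym (≤ʷ⇒hamming-additive u≤x)) (walk-length≥hamming walk)

proposition4 : (h : ℕ) (X : Subset h) (x y u v : Word h) →
    Maximal X x → Maximal X y → ¬ (x ≡ y) →
    Interval X (0ʰ h) x u → Interval X (0ʰ h) y v →
    ¬ (Interval X (0ʰ h) x u × Interval X (0ʰ h) y u) →
    ¬ (Interval X (0ʰ h) x v × Interval X (0ʰ h) y v) →
    ¬ EdgeQ X u v
proposition4 h X x y u v (x∈X , _) (y∈X , _) _ u∈Ix v∈Iy u∉both v∉both (_ , _ , u~v)
  with adjacent⇒comparable u~v
... | inj₁ u≤v = u∉both (u∈Ix , ≤ʷ⇒interval-0ʰ y∈G (≤ʷ-trans u≤v (interval-0ʰ⇒≤ʷ y∈G v∈Iy)))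
  where y∈G = ∈⇒∈VQ y∈X
... | inj₂ v≤u = v∉both (≤ʷ⇒interval-0ʰ x∈G (≤ʷ-trans v≤u (interval-0ʰ⇒≤ʷ x∈G u∈Ix)) , v∈Iy)
  where x∈G = ∈⇒∈VQ x∈X
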